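{- If $D$ is a digraph with $\dim(D)\le 2$, then $D$ does not contain a directed path of length two as an induced subdigraph; that is, there are no three vertices $v_1,v_2,v_3$ of $D$ with $(v_1,v_2),(v_2,v_3)\in A(D)$ and no arc between $v_1$ and $v_3$.
   Context: All digraphs are finite and have simple underlying graphs (no loops, no multiple arcs, and at most one arc between any two vertices). For an integer $d\ge 0$ write $[d]=\{1,\dots,d\}$ (with $\mathbb{R}^0=\{0\}$). For $x,y\in\mathbb{R}^d$ let $\mathcal{G}_{x>y}=\{i\in[d]: x_i>y_i\}$. The weak majority relation: $x\succ y$ iff $|\mathcal{G}_{x>y}|-|\mathcal{G}_{y>x}|>0$. A map $f:V(D)\to\mathbb{R}^d$ is an $\mathbb{R}^d$-realizer of $D$ if for all vertices $x,y$: $(x,y)\in A(D)$ iff $f(x)\succ f(y)$. The weak majority dimension $\dim(D)$ is the minimum nonnegative integer $d$ such that $D$ has an $\mathbb{R}^d$-realizer (such $d$ always exists). -}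

module Defs where

open import Level using (Level; _⊔_)
open import Data.Nat using (ℕ; zero; suc; _+_; _<_; _≤_)
open import Data.Fin using (Fin; zero; suc)
open import Data.Product using (Σ; _×_; ∃-syntax)
open import Relation.Nullary using (¬_)
open import Relation.Binary.Bundles using (StrictTotalOrder)
open import Relation.Binary.Definitions using (Tri; tri<; tri≈; tri>)

record Digraph : Set₁ where
  field
    n       : ℕ
    Arc     : Fin n → Fin n → Set
    noLoop  : ∀ x → ¬ Arc x x
    noDouble : ∀ x y → Arc x y → ¬ Arc y x
open Digraph public

sumF : (d : ℕ) → (Fin d → ℕ) → ℕ
sumF zero    f = 0
sumF (suc d) f = f zero + sumF d (λ i → f (suc i))

triGt : ∀ {p q r : Level} {a : Set p} {b : Set q} {c : Set r} → Tri a b c → ℕ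
triGt (tri< _ _ _) = 0
triGt (tri≈ _ _ _) = 0
triGt (tri> _ _ _) = 1

module _ {c ℓ₁ ℓ₂ : Level} (O : StrictTotalOrder c ℓ₁ ℓ₂) where
  open StrictTotalOrder O using (compare) renaming (Carrier to C)

  countGt : (d : ℕ) → (Fin d → C) → (Fin d → C) → ℕ
  countGt d x y = sumF d (λ i → triGt (compare (x i) (y i)))

  -- weak majority relation x ≻ y : |G_{x>y}| - |G_{y>x}| > 0
  _≻_ : {d : ℕ} → (Fin d → C) → (Fin d → C) → Set
  _≻_ {d} x y = countGt d y x < countGt d x y

  IsRealizer : (D : Digraph) (d : ℕ) → (Fin (n D) → Fin d → C) → Set
  IsRealizer D d f = ∀ x y → (Arc D x y → f x ≻ f y) × (f x ≻ f y → Arc D x y)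

  DimLe : Digraph → ℕ → Set c
  DimLe D k = ∃[ d ] (d ≤ k × ∃[ f ] IsRealizer D d f)

HasInducedP3 : Digraph → Set
HasInducedP3 D = ∃[ v₁ ] ∃[ v₂ ] ∃[ v₃ ]
  (Arc D v₁ v₂ × Arc D v₂ v₃ × ¬ Arc D v₁ v₃ × ¬ Arc D v₃ v₁)

module Submission where

-- Call x ∈ C^d a Pareto dominator of y when no
-- coordinate of x lies below the corresponding coordinate of y and at
-- least one lies strictly above.  Pareto dominance always implies the
-- weak majority relation x ≻ y, and it is transitive.  In dimension at
-- most 2 the converse also holds: each coordinate is won by at most one
-- side, so at most 2 coordinates are decided, and a strict majority
-- among at most 2 votes leaves the loser with none.  Hence ≻ is
-- transitive on C^d for d ≤ 2.  If D were realized in dimension ≤ 2 and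
-- contained an induced path v₁ → v₂ → v₃, transitivity of ≻ would give
-- f v₁ ≻ f v₃ and thus the forbidden arc v₁ → v₃.

open import Defs
open import Level using (Level)
open import Relation.Nullary using (¬_)
open import Relation.Binary.Bundles using (StrictTotalOrder)
open import Relation.Binary.Definitions using (tri<; tri≈; tri>)
open import Relation.Binary.PropositionalEquality
  using (_≡_; refl; sym; cong; cong₂; subst; module ≡-Reasoning)
open import Data.Nat using (ℕ; zero; suc; _+_; _≤_; _<_; z≤n; s≤s)
open import Data.Nat.Properties
  using (+-commutativeSemigroup; +-mono-≤; m≤m+n; m≤n+m; ≤-trans; ≤-<-trans; ≤-reflexive;
         m+n≡0⇒m≡0; m+n≡0⇒n≡0; m+n≤o⇒n≤o; 1+n≰n; module ≤-Reasoning)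
open import Algebra.Properties.CommutativeSemigroup +-commutativeSemigroup
  using (interchange)
open import Data.Fin using (Fin; zero; suc)
open import Data.Product using (_×_; _,_; ∃-syntax; proj₁; proj₂)
open import Data.Empty using (⊥-elim)

sumF-zero⇒ : ∀ d (f : Fin d → ℕ) → sumF d f ≡ 0 → ∀ i → f i ≡ 0
sumF-zero⇒ (suc d) f s≡0 zero    = m+n≡0⇒m≡0 (f zero) s≡0
sumF-zero⇒ (suc d) f s≡0 (suc i) =
  sumF-zero⇒ d (λ j → f (suc j)) (m+n≡0⇒n≡0 (f zero) s≡0) i

sumF-allZero : ∀ d (f : Fin d → ℕ) → (∀ i → f i ≡ 0) → sumF d f ≡ 0
sumF-allZero zero    f f≡0 = refl
sumF-allZero (suc d) f f≡0 =
  cong₂ _+_ (f≡0 zero) (sumF-allZero d (λ i → f (suc i)) (λ i → f≡0 (suc i)))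

sumF-pos⇒ : ∀ d (f : Fin d → ℕ) → 0 < sumF d f → ∃[ i ] 0 < f i
sumF-pos⇒ (suc d) f pos with f zero in eq
... | suc _ = zero , subst (0 <_) (sym eq) (s≤s z≤n)
... | zero  with sumF-pos⇒ d (λ i → f (suc i)) pos
...   | i , fi>0 = suc i , fi>0

sumF-≥summand : ∀ d (f : Fin d → ℕ) i → f i ≤ sumF d f
sumF-≥summand (suc d) f zero    = m≤m+n (f zero) _
sumF-≥summand (suc d) f (suc i) =
  ≤-trans (sumF-≥summand d (λ j → f (suc j)) i) (m≤n+m _ (f zero))

sumF-+ : ∀ d (f g : Fin d → ℕ) → sumF d f + sumF d g ≡ sumF d (λ i → f i + g i)
sumF-+ zero    f g = refl
sumF-+ (suc d) f g = begin
  (f zero + sumF d f′) + (g zero + sumF d g′) ≡⟨ interchange (f zero) _ (g zero) _ ⟩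
  (f zero + g zero) + (sumF d f′ + sumF d g′) ≡⟨ cong (f zero + g zero +_) (sumF-+ d f′ g′) ⟩
  (f zero + g zero) + sumF d (λ i → f′ i + g′ i) ∎
  where
  open ≡-Reasoning
  f′ g′ : Fin d → ℕ
  f′ i = f (suc i)
  g′ i = g (suc i)

sumF-≤1 : ∀ d (f : Fin d → ℕ) → (∀ i → f i ≤ 1) → sumF d f ≤ d
sumF-≤1 zero    f f≤1 = z≤n
sumF-≤1 (suc d) f f≤1 =
  +-mono-≤ (f≤1 zero) (sumF-≤1 d (λ i → f (suc i)) (λ i → f≤1 (suc i)))

majority-of-two : ∀ {a b} → a < b → a + b ≤ 2 → a ≡ 0
majority-of-two {zero}      _     _             = refl
majority-of-two {suc a} {b} 1+a<b (s≤s a+b≤1) = ⊥-elim (1+n≰n 2≤b≤1)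
  where
  2≤b≤1 : 2 ≤ 1
  2≤b≤1 = ≤-trans (≤-trans (s≤s (s≤s z≤n)) 1+a<b) (m+n≤o⇒n≤o a a+b≤1)

module ParetoDominance {c ℓ₁ ℓ₂ : Level} (O : StrictTotalOrder c ℓ₁ ℓ₂) where
  open StrictTotalOrder O renaming (Carrier to C; _<_ to _⊏_)

  above : C → C → ℕ
  above a b = triGt (compare a b)

  above-≡1 : ∀ {a b} → b ⊏ a → above a b ≡ 1
  above-≡1 {a} {b} b⊏a with compare a b
  ... | tri< _ _ b⋢a = ⊥-elim (b⋢a b⊏a)
  ... | tri≈ _ _ b⋢a = ⊥-elim (b⋢a b⊏a)
  ... | tri> _ _ _   = refl

  above-≡0 : ∀ {a b} → ¬ (b ⊏ a) → above a b ≡ 0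
  above-≡0 {a} {b} b⋢a with compare a b
  ... | tri< _ _ _   = refl
  ... | tri≈ _ _ _   = refl
  ... | tri> _ _ b⊏a = ⊥-elim (b⋢a b⊏a)

  above-pos⇒ : ∀ {a b} → 0 < above a b → b ⊏ a
  above-pos⇒ {a} {b} pos with compare a b
  above-pos⇒ () | tri< _ _ _
  above-pos⇒ () | tri≈ _ _ _
  above-pos⇒ _  | tri> _ _ b⊏a = b⊏a

  above-zero⇒ : ∀ {a b} → above a b ≡ 0 → ¬ (b ⊏ a)
  above-zero⇒ {a} {b} ≡0 b⊏a with compare a b
  above-zero⇒ _  b⊏a | tri< _ _ b⋢a = b⋢a b⊏a
  above-zero⇒ _  b⊏a | tri≈ _ _ b⋢a = b⋢a b⊏a
  above-zero⇒ () _   | tri> _ _ _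

  above-≤1 : ∀ a b → above a b ≤ 1
  above-≤1 a b with compare a b
  ... | tri< _ _ _ = z≤n
  ... | tri≈ _ _ _ = z≤n
  ... | tri> _ _ _ = s≤s z≤n

  above-exclusive : ∀ a b → above a b + above b a ≤ 1
  above-exclusive a b with compare a b
  ... | tri< _ _ _   = above-≤1 b a
  ... | tri≈ _ _ _   = above-≤1 b a
  ... | tri> _ _ b⊏a = ≤-reflexive (cong suc (above-≡0 (asym b⊏a)))

  Dominates : ∀ {d} → (Fin d → C) → (Fin d → C) → Set ℓ₂
  Dominates {d} x y = (∀ i → ¬ (x i ⊏ y i)) × ∃[ i ] (y i ⊏ x i)

  dominates⇒≻ : ∀ {d} (x y : Fin d → C) → Dominates x y → _≻_ O x y
  dominates⇒≻ {d} x y (x⋢y , i , yi⊏xi) = begin-strict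
    countGt O d y x   ≡⟨ sumF-allZero d _ (λ j → above-≡0 (x⋢y j)) ⟩
    0                 <⟨ s≤s z≤n ⟩
    1                 ≡⟨ sym (above-≡1 yi⊏xi) ⟩
    above (x i) (y i) ≤⟨ sumF-≥summand d _ i ⟩
    countGt O d x y   ∎
    where open ≤-Reasoning

  ≻⇒dominates : ∀ {d} → d ≤ 2 → (x y : Fin d → C) → _≻_ O x y → Dominates x y
  ≻⇒dominates {d} d≤2 x y x≻y = x⋢y , strict
    where
    votes≤2 : countGt O d y x + countGt O d x y ≤ 2
    votes≤2 = begin
      countGt O d y x + countGt O d x y            ≡⟨ sumF-+ d _ _ ⟩
      sumF d (λ i → above (y i) (x i) + above (x i) (y i))
                                                   ≤⟨ sumF-≤1 d _ (λ i → above-exclusive (y i) (x i)) ⟩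
      d                                            ≤⟨ d≤2 ⟩
      2                                            ∎
      where open ≤-Reasoning
    x⋢y : ∀ i → ¬ (x i ⊏ y i)
    x⋢y i = above-zero⇒ (sumF-zero⇒ d _ (majority-of-two x≻y votes≤2) i)
    strict : ∃[ i ] (y i ⊏ x i)
    strict with sumF-pos⇒ d _ (≤-<-trans z≤n x≻y)
    ... | i , pos = i , above-pos⇒ pos

  ⋢-trans : ∀ {a b c} → ¬ (a ⊏ b) → ¬ (b ⊏ c) → ¬ (a ⊏ c)
  ⋢-trans {a} {b} {c} a⋢b b⋢c a⊏c with compare a b
  ... | tri< a⊏b _ _   = a⋢b a⊏b
  ... | tri≈ _ a≈b _   = b⋢c (proj₂ <-resp-≈ a≈b a⊏c)
  ... | tri> _ _ b⊏a   = b⋢c (trans b⊏a a⊏c)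

  ⊏-⋢-trans : ∀ {a b c} → b ⊏ a → ¬ (b ⊏ c) → c ⊏ a
  ⊏-⋢-trans {a} {b} {c} b⊏a b⋢c with compare b c
  ... | tri< b⊏c _ _ = ⊥-elim (b⋢c b⊏c)
  ... | tri≈ _ b≈c _ = proj₂ <-resp-≈ b≈c b⊏a
  ... | tri> _ _ c⊏b = trans c⊏b b⊏a

  dominates-trans : ∀ {d} {x y z : Fin d → C} → Dominates x y → Dominates y z → Dominates x z
  dominates-trans (x⋢y , i , yi⊏xi) (y⋢z , _) =
    (λ j → ⋢-trans (x⋢y j) (y⋢z j)) , i , ⊏-⋢-trans yi⊏xi (y⋢z i)

  ≻-trans : ∀ {d} → d ≤ 2 → {x y z : Fin d → C} → _≻_ O x y → _≻_ O y z → _≻_ O x z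
  ≻-trans d≤2 {x} {y} {z} x≻y y≻z = dominates⇒≻ x z
    (dominates-trans (≻⇒dominates d≤2 x y x≻y) (≻⇒dominates d≤2 y z y≻z))

corollary3p5 : ∀ {c ℓ₁ ℓ₂ : Level} (O : StrictTotalOrder c ℓ₁ ℓ₂) (D : Digraph)
               → DimLe O D 2 → ¬ HasInducedP3 D
corollary3p5 O D (d , d≤2 , f , realizes) (v₁ , v₂ , v₃ , v₁→v₂ , v₂→v₃ , v₁↛v₃ , _) =
  v₁↛v₃ (arc⇐ v₁ v₃ (≻-trans d≤2 (arc⇒ v₁ v₂ v₁→v₂) (arc⇒ v₂ v₃ v₂→v₃)))
  where
  open ParetoDominance O
  arc⇒ : ∀ u v → Arc D u v → _≻_ O (f u) (f v)
  arc⇒ u v = proj₁ (realizes u v)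
  arc⇐ : ∀ u v → _≻_ O (f u) (f v) → Arc D u v
  arc⇐ u v = proj₂ (realizes u v)
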